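{- For all positive integers $n$ and $k$, $$\frac{\zeta_{n-1}(1_{k-1})}{n}+\sum_{\substack{i+j=n\\ i,j\ge1}}\frac{\zeta_{i-1}(1_{k-1})}{i}\,\frac{\binom{2j}{j}}{4^j}=\frac{1}{4^n}\binom{2n}{n}\,2^k\,t_n(1_k).$$
   Context: For a composition $\mathbf{k}=(k_1,\dots,k_r)$ and $n\in\mathbb{N}_0$: $\zeta_n(\mathbf{k})=\sum_{n\ge n_1>\cdots>n_r>0}\prod_j n_j^{ -k_j}$ and the multiple $t$-harmonic sum $t_n(\mathbf{k})=\sum_{n\ge n_1>\cdots>n_r>0}\prod_j (2n_j-1)^{ -k_j}$, with value $1$ for the empty composition (empty sums are $0$). $1_d$ denotes the string of $d$ ones. -}

module Defs where

open import Data.Nat as ℕ using (ℕ; zero; suc)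
open import Data.Nat.Properties using (m^n≢0)
open import Data.Nat.Combinatorics using (_C_)
open import Data.Integer using (+_)
open import Data.Rational using (ℚ; 0ℚ; 1ℚ; _+_; _*_; _/_)
open import Data.List using (List; []; _∷_; replicate)

Composition : Set
Composition = List ℕ

-- 1 / d as a rational, for d ≥ 1 (only ever used with d ≥ 1; 1/0 := 0 is a junk value).
inv : ℕ → ℚ
inv zero    = 0ℚ
inv (suc d) = + 1 / suc d

-- ζ_n(k) = Σ_{n ≥ n₁ > ⋯ > n_r > 0} Π n_j^{-k_j};  ζ_n(∅) = 1.
-- Recursively: ζ_n(k₁,k') = Σ_{m=1}^{n} m^{-k₁} ζ_{m-1}(k').
ζ : ℕ → Composition → ℚ
ζ n       []       = 1ℚ
ζ zero    (k ∷ ks) = 0ℚ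
ζ (suc m) (k ∷ ks) = ζ m (k ∷ ks) + inv (suc m ℕ.^ k) * ζ m ks

-- t_n(k) = Σ_{n ≥ n₁ > ⋯ > n_r > 0} Π (2n_j - 1)^{-k_j};  t_n(∅) = 1.
t : ℕ → Composition → ℚ
t n       []       = 1ℚ
t zero    (k ∷ ks) = 0ℚ
t (suc m) (k ∷ ks) = t m (k ∷ ks) + inv ((2 ℕ.* m ℕ.+ 1) ℕ.^ k) * t m ks

ones : ℕ → Composition
ones d = replicate d 1

centralRatio : ℕ → ℚ
centralRatio j = _/_ (+ ((2 ℕ.* j) C j)) (4 ℕ.^ j) {{m^n≢0 4 j}}

sumFrom1 : ℕ → (ℕ → ℚ) → ℚ
sumFrom1 zero    g = 0ℚ
sumFrom1 (suc m) g = sumFrom1 m g + g (suc m)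

-- Σ_{i+j=n, i,j ≥ 1} f i j  =  Σ_{i=1}^{n-1} f i (n - i)
sumSplit : ℕ → (ℕ → ℕ → ℚ) → ℚ
sumSplit n f = sumFrom1 (n ℕ.∸ 1) (λ i → f i (n ℕ.∸ i))

{-# OPTIONS --safe #-}
module Submission where

-- Let A_k(x) = Σ_{i≥1} ζ_{i−1}(1_{k−1}) x^i / i (and A_0 = 1) and C(x) = Σ_j binom(2j,j) (x/4)^j,
-- so that the left-hand side is the coefficient of x^n in F_k = A_k C.  Since
-- ζ_i(1_k) − ζ_{i−1}(1_k) = ζ_{i−1}(1_{k−1}) / i we have (1 − x) A_k′ = A_{k−1}, and C = (1 − x)^{−1/2}
-- gives (1 − x) C′ = C / 2.  By the product rule (1 − x) F_k′ = F_{k−1} + F_k / 2, that is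
-- (n + 1) f_k(n + 1) = (n + ½) f_k(n) + f_{k−1}(n) for the coefficients f_k.  The right-hand side obeys
-- the same recurrence because t_{n+1}(1_k) = t_n(1_k) + t_n(1_{k−1}) / (2n + 1), both sides vanish at
-- n = 0 when k ≥ 1, and for k = 0 both are binom(2n,n)/4^n; induction on k and n concludes.

open import Defs
open import Algebra.Bundles using (CommutativeMonoid)
open import Data.Integer as ℤ using (+_)
import Data.Integer.Properties as ℤ
open import Data.Nat as ℕ using (ℕ; suc; zero; NonZero; _!)
open import Data.Nat.Combinatorics using (_C_; nCk≡n!/k![n-k]!; k![n∸k]!∣n!)
open import Data.Nat.DivMod using (m/n*n≡m)
open import Data.Nat.Properties as ℕ using (m^n≢0; _!≢0; _!*_!≢0)
open import Data.Nat.Tactic.RingSolver using () renaming (solve-∀ to ℕ-solve-∀)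
open import Data.Rational using (ℚ; _+_; _*_; _/_; 0ℚ; 1ℚ; ½; toℚᵘ; _≟_)
open import Data.Rational.Properties
open import Data.Rational.Unnormalised as ℚᵘ using (mkℚᵘ; *≡*)
import Data.Rational.Unnormalised.Properties as ℚᵘ
open import Function using (_∘_)
open import Level using (0ℓ)
open import Relation.Binary.PropositionalEquality
  using (_≡_; refl; sym; trans; cong; cong₂; module ≡-Reasoning)
open import Relation.Nullary.Decidable using (dec⇒maybe)
open import Tactic.RingSolver using (solve-∀)
open import Tactic.RingSolver.Core.AlmostCommutativeRing
  using (AlmostCommutativeRing; fromCommutativeRing)

open import Algebra.Properties.CommutativeSemigroup
  (CommutativeMonoid.commutativeSemigroup *-1-commutativeMonoid)
  using (x∙yz≈y∙xz)
open import Algebra.Properties.CommutativeSemigroup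
  (CommutativeMonoid.commutativeSemigroup +-0-commutativeMonoid)
  using () renaming (interchange to +-interchange)

ℚ-ring : AlmostCommutativeRing 0ℓ 0ℓ
ℚ-ring = fromCommutativeRing +-*-commutativeRing (λ x → dec⇒maybe (0ℚ ≟ x))

fromℕ : ℕ → ℚ
fromℕ n = + n / 1

toℚᵘ-fromℕ : ∀ n → toℚᵘ (fromℕ n) ℚᵘ.≃ mkℚᵘ (+ n) 0
toℚᵘ-fromℕ n = toℚᵘ-fromℚᵘ (mkℚᵘ (+ n) 0)

fromℕ-+ : ∀ m n → fromℕ (m ℕ.+ n) ≡ fromℕ m + fromℕ n
fromℕ-+ m n = toℚᵘ-injective (begin
  toℚᵘ (fromℕ (m ℕ.+ n))                 ≈⟨ toℚᵘ-fromℕ (m ℕ.+ n) ⟩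
  mkℚᵘ (+ (m ℕ.+ n)) 0                   ≡⟨ cong (λ z → mkℚᵘ z 0) numerators ⟩
  mkℚᵘ (+ m) 0 ℚᵘ.+ mkℚᵘ (+ n) 0         ≈⟨ ℚᵘ.+-cong (toℚᵘ-fromℕ m) (toℚᵘ-fromℕ n) ⟨
  toℚᵘ (fromℕ m) ℚᵘ.+ toℚᵘ (fromℕ n)     ≈⟨ toℚᵘ-homo-+ (fromℕ m) (fromℕ n) ⟨
  toℚᵘ (fromℕ m + fromℕ n)               ∎)
  where
  open ℚᵘ.≃-Reasoning
  numerators : + (m ℕ.+ n) ≡ + m ℤ.* + 1 ℤ.+ + n ℤ.* + 1
  numerators = trans (ℤ.pos-+ m n) (sym (cong₂ ℤ._+_ (ℤ.*-identityʳ (+ m)) (ℤ.*-identityʳ (+ n))))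

fromℕ-* : ∀ m n → fromℕ (m ℕ.* n) ≡ fromℕ m * fromℕ n
fromℕ-* m n = toℚᵘ-injective (begin
  toℚᵘ (fromℕ (m ℕ.* n))                 ≈⟨ toℚᵘ-fromℕ (m ℕ.* n) ⟩
  mkℚᵘ (+ (m ℕ.* n)) 0                   ≡⟨ cong (λ z → mkℚᵘ z 0) (ℤ.pos-* m n) ⟩
  mkℚᵘ (+ m) 0 ℚᵘ.* mkℚᵘ (+ n) 0         ≈⟨ ℚᵘ.*-cong (toℚᵘ-fromℕ m) (toℚᵘ-fromℕ n) ⟨
  toℚᵘ (fromℕ m) ℚᵘ.* toℚᵘ (fromℕ n)     ≈⟨ toℚᵘ-homo-* (fromℕ m) (fromℕ n) ⟨
  toℚᵘ (fromℕ m * fromℕ n)               ∎)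
  where open ℚᵘ.≃-Reasoning

fromℕ-suc : ∀ n → fromℕ (suc n) ≡ fromℕ n + 1ℚ
fromℕ-suc n = trans (cong fromℕ (ℕ.+-comm 1 n)) (fromℕ-+ n 1)

fromℕ-*-/ : ∀ a d .{{_ : NonZero d}} → fromℕ d * (+ a / d) ≡ fromℕ a
fromℕ-*-/ a d@(suc d-1) = toℚᵘ-injective (begin
  toℚᵘ (fromℕ d * (+ a / d))             ≈⟨ toℚᵘ-homo-* (fromℕ d) (+ a / d) ⟩
  toℚᵘ (fromℕ d) ℚᵘ.* toℚᵘ (+ a / d)     ≈⟨ ℚᵘ.*-cong (toℚᵘ-fromℕ d) (toℚᵘ-fromℚᵘ (mkℚᵘ (+ a) d-1)) ⟩
  mkℚᵘ (+ d) 0 ℚᵘ.* mkℚᵘ (+ a) d-1       ≈⟨ *≡* cross ⟩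
  mkℚᵘ (+ a) 0                           ≈⟨ toℚᵘ-fromℕ a ⟨
  toℚᵘ (fromℕ a)                         ∎)
  where
  open ℚᵘ.≃-Reasoning
  cross : (+ d ℤ.* + a) ℤ.* + 1 ≡ + a ℤ.* + (1 ℕ.* d)
  cross = trans (ℤ.*-identityʳ (+ d ℤ.* + a))
    (trans (ℤ.*-comm (+ d) (+ a)) (cong (λ z → + a ℤ.* + z) (sym (ℕ.*-identityˡ d))))

fromℕ-*-inv : ∀ d .{{_ : NonZero d}} → fromℕ d * (+ 1 / d) ≡ 1ℚ
fromℕ-*-inv = fromℕ-*-/ 1

fromℕ-*-*-inv : ∀ i x → fromℕ (suc i) * (x * inv (suc i)) ≡ x
fromℕ-*-*-inv i x = begin
  fromℕ (suc i) * (x * inv (suc i)) ≡⟨ x∙yz≈y∙xz (fromℕ (suc i)) x (inv (suc i)) ⟩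
  x * (fromℕ (suc i) * inv (suc i)) ≡⟨ cong (x *_) (fromℕ-*-inv (suc i)) ⟩
  x * 1ℚ                            ≡⟨ *-identityʳ x ⟩
  x                                 ∎
  where open ≡-Reasoning

*-cancelˡ-fromℕ : ∀ d .{{_ : NonZero d}} {x y} → fromℕ d * x ≡ fromℕ d * y → x ≡ y
*-cancelˡ-fromℕ d {x} {y} eq =
  trans (sym (inv-*-fromℕ-* x)) (trans (cong (+ 1 / d *_) eq) (inv-*-fromℕ-* y))
  where
  inv-*-fromℕ-* : ∀ z → + 1 / d * (fromℕ d * z) ≡ z
  inv-*-fromℕ-* z = begin
    + 1 / d * (fromℕ d * z) ≡⟨ *-assoc (+ 1 / d) (fromℕ d) z ⟨
    + 1 / d * fromℕ d * z   ≡⟨ cong (_* z) (trans (*-comm (+ 1 / d) (fromℕ d)) (fromℕ-*-inv d)) ⟩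
    1ℚ * z                  ≡⟨ *-identityˡ z ⟩
    z                       ∎
    where open ≡-Reasoning

infixl 7 _⋆_

_⋆_ : (ℕ → ℚ) → (ℕ → ℚ) → ℕ → ℚ
(a ⋆ c) zero    = a 0 * c 0
(a ⋆ c) (suc n) = a 0 * c (suc n) + (a ∘ suc ⋆ c) n

ε : ℕ → ℚ
ε zero    = 1ℚ
ε (suc _) = 0ℚ

⋆-cong : ∀ {a a′ c c′} → (∀ i → a i ≡ a′ i) → (∀ j → c j ≡ c′ j) → ∀ n → (a ⋆ c) n ≡ (a′ ⋆ c′) n
⋆-cong a≡a′ c≡c′ zero    = cong₂ _*_ (a≡a′ 0) (c≡c′ 0)
⋆-cong a≡a′ c≡c′ (suc n) = cong₂ _+_ (cong₂ _*_ (a≡a′ 0) (c≡c′ (suc n))) (⋆-cong (a≡a′ ∘ suc) c≡c′ n)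

⋆-zeroˡ : ∀ c n → ((λ _ → 0ℚ) ⋆ c) n ≡ 0ℚ
⋆-zeroˡ c zero    = *-zeroˡ (c 0)
⋆-zeroˡ c (suc n) = cong₂ _+_ (*-zeroˡ (c (suc n))) (⋆-zeroˡ c n)

⋆-identityˡ : ∀ c n → (ε ⋆ c) n ≡ c n
⋆-identityˡ c zero    = *-identityˡ (c 0)
⋆-identityˡ c (suc n) = begin
  1ℚ * c (suc n) + ((λ _ → 0ℚ) ⋆ c) n ≡⟨ cong₂ _+_ (*-identityˡ (c (suc n))) (⋆-zeroˡ c n) ⟩
  c (suc n) + 0ℚ                      ≡⟨ +-identityʳ (c (suc n)) ⟩
  c (suc n)                           ∎
  where open ≡-Reasoning

⋆-distribʳ-+ : ∀ a b c n → ((λ i → a i + b i) ⋆ c) n ≡ (a ⋆ c) n + (b ⋆ c) n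
⋆-distribʳ-+ a b c zero    = *-distribʳ-+ (c 0) (a 0) (b 0)
⋆-distribʳ-+ a b c (suc n) = trans
  (cong₂ _+_ (*-distribʳ-+ (c (suc n)) (a 0) (b 0)) (⋆-distribʳ-+ (a ∘ suc) (b ∘ suc) c n))
  (+-interchange (a 0 * c (suc n)) (b 0 * c (suc n)) _ _)

⋆-distribˡ-+ : ∀ a c d n → (a ⋆ (λ j → c j + d j)) n ≡ (a ⋆ c) n + (a ⋆ d) n
⋆-distribˡ-+ a c d zero    = *-distribˡ-+ (a 0) (c 0) (d 0)
⋆-distribˡ-+ a c d (suc n) = trans
  (cong₂ _+_ (*-distribˡ-+ (a 0) (c (suc n)) (d (suc n))) (⋆-distribˡ-+ (a ∘ suc) c d n))
  (+-interchange (a 0 * c (suc n)) (a 0 * d (suc n)) _ _)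

⋆-scaleʳ : ∀ r a c n → (a ⋆ (λ j → r * c j)) n ≡ r * (a ⋆ c) n
⋆-scaleʳ r a c zero    = x∙yz≈y∙xz (a 0) r (c 0)
⋆-scaleʳ r a c (suc n) = trans
  (cong₂ _+_ (x∙yz≈y∙xz (a 0) r (c (suc n))) (⋆-scaleʳ r (a ∘ suc) c n))
  (sym (*-distribˡ-+ r (a 0 * c (suc n)) _))

⋆-sucʳ : ∀ a c n → (a ⋆ c) (suc n) ≡ (a ⋆ c ∘ suc) n + a (suc n) * c 0
⋆-sucʳ a c zero    = refl
⋆-sucʳ a c (suc n) = trans (cong (_+_ (a 0 * c (suc (suc n)))) (⋆-sucʳ (a ∘ suc) c n))
  (sym (+-assoc (a 0 * c (suc (suc n))) _ _))

-- On generating functions ⋆ is the product and θ is x d/dx.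
θ : (ℕ → ℚ) → ℕ → ℚ
θ a i = fromℕ i * a i

θ-zero : ∀ a → θ a 0 ≡ 0ℚ
θ-zero a = *-zeroˡ (a 0)

θ-suc : ∀ a i → θ a (suc i) ≡ θ (a ∘ suc) i + a (suc i)
θ-suc a i = begin
  fromℕ (suc i) * a (suc i)             ≡⟨ cong (_* a (suc i)) (fromℕ-suc i) ⟩
  (fromℕ i + 1ℚ) * a (suc i)            ≡⟨ *-distribʳ-+ (a (suc i)) (fromℕ i) 1ℚ ⟩
  fromℕ i * a (suc i) + 1ℚ * a (suc i)  ≡⟨ cong (_+_ (fromℕ i * a (suc i))) (*-identityˡ (a (suc i))) ⟩
  fromℕ i * a (suc i) + a (suc i)       ∎
  where open ≡-Reasoning

θ-⋆-suc : ∀ a c n → (θ a ⋆ c) (suc n) ≡ (θ a ∘ suc ⋆ c) n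
θ-⋆-suc a c n = begin
  θ a 0 * c (suc n) + (θ a ∘ suc ⋆ c) n ≡⟨ cong (λ u → u * c (suc n) + (θ a ∘ suc ⋆ c) n) (θ-zero a) ⟩
  0ℚ * c (suc n) + (θ a ∘ suc ⋆ c) n    ≡⟨ cong (_+ (θ a ∘ suc ⋆ c) n) (*-zeroˡ (c (suc n))) ⟩
  0ℚ + (θ a ∘ suc ⋆ c) n                ≡⟨ +-identityˡ ((θ a ∘ suc ⋆ c) n) ⟩
  (θ a ∘ suc ⋆ c) n                     ∎
  where open ≡-Reasoning

⋆-leibniz : ∀ a c n → θ (a ⋆ c) n ≡ (θ a ⋆ c) n + (a ⋆ θ c) n
⋆-leibniz a c zero    = regroup (a 0) (c 0)
  where
  regroup : ∀ x y → 0ℚ * (x * y) ≡ 0ℚ * x * y + x * (0ℚ * y)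
  regroup = solve-∀ ℚ-ring
⋆-leibniz a c (suc n) = begin
  fromℕ (suc n) * (a 0 * c (suc n) + X)
    ≡⟨ cong (_* (a 0 * c (suc n) + X)) (fromℕ-suc n) ⟩
  (fromℕ n + 1ℚ) * (a 0 * c (suc n) + X)
    ≡⟨ expand (fromℕ n) (a 0) (c (suc n)) X ⟩
  fromℕ n * X + (X + a 0 * ((fromℕ n + 1ℚ) * c (suc n)))
    ≡⟨ cong₂ (λ u v → u + (X + a 0 * (v * c (suc n)))) (⋆-leibniz (a ∘ suc) c n) (sym (fromℕ-suc n)) ⟩
  (P + Q) + (X + a 0 * θ c (suc n))
    ≡⟨ regroup P Q X (a 0 * θ c (suc n)) ⟩
  (P + X) + (a 0 * θ c (suc n) + Q)
    ≡⟨ cong (_+ (a ⋆ θ c) (suc n)) (trans (sym shifted) (sym (θ-⋆-suc a c n))) ⟩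
  (θ a ⋆ c) (suc n) + (a ⋆ θ c) (suc n)
    ∎
  where
  open ≡-Reasoning
  X = (a ∘ suc ⋆ c) n
  P = (θ (a ∘ suc) ⋆ c) n
  Q = (a ∘ suc ⋆ θ c) n
  shifted : (θ a ∘ suc ⋆ c) n ≡ P + X
  shifted = trans (⋆-cong (θ-suc a) (λ _ → refl) n) (⋆-distribʳ-+ (θ (a ∘ suc)) (a ∘ suc) c n)
  expand : ∀ u x y z → (u + 1ℚ) * (x * y + z) ≡ u * z + (z + x * ((u + 1ℚ) * y))
  expand = solve-∀ ℚ-ring
  regroup : ∀ p q z v → (p + q) + (z + v) ≡ (p + z) + (v + q)
  regroup = solve-∀ ℚ-ring

⋆-θ-suc : ∀ a c n → (a ⋆ θ c) (suc n) ≡ (a ⋆ θ c ∘ suc) n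
⋆-θ-suc a c n = begin
  (a ⋆ θ c) (suc n)                       ≡⟨ ⋆-sucʳ a (θ c) n ⟩
  (a ⋆ θ c ∘ suc) n + a (suc n) * θ c 0   ≡⟨ cong (λ u → (a ⋆ θ c ∘ suc) n + a (suc n) * u) (θ-zero c) ⟩
  (a ⋆ θ c ∘ suc) n + a (suc n) * 0ℚ      ≡⟨ cong (_+_ ((a ⋆ θ c ∘ suc) n)) (*-zeroʳ (a (suc n))) ⟩
  (a ⋆ θ c ∘ suc) n + 0ℚ                  ≡⟨ +-identityʳ ((a ⋆ θ c ∘ suc) n) ⟩
  (a ⋆ θ c ∘ suc) n                       ∎
  where open ≡-Reasoning

-- The product rule for (1 − x) d/dx: the hypotheses say (1 − x) A′ = B and (1 − x) C′ = D.
⋆-recurrence : ∀ {a b c d} →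
  (∀ i → fromℕ (suc i) * a (suc i) ≡ θ a i + b i) →
  (∀ j → fromℕ (suc j) * c (suc j) ≡ θ c j + d j) →
  ∀ n → fromℕ (suc n) * (a ⋆ c) (suc n) ≡ θ (a ⋆ c) n + (b ⋆ c) n + (a ⋆ d) n
⋆-recurrence {a} {b} {c} {d} a-rec c-rec n = begin
  θ (a ⋆ c) (suc n)
    ≡⟨ ⋆-leibniz a c (suc n) ⟩
  (θ a ⋆ c) (suc n) + (a ⋆ θ c) (suc n)
    ≡⟨ cong₂ _+_ (θ-⋆-suc a c n) (⋆-θ-suc a c n) ⟩
  (θ a ∘ suc ⋆ c) n + (a ⋆ θ c ∘ suc) n
    ≡⟨ cong₂ _+_ (trans (⋆-cong a-rec (λ _ → refl) n) (⋆-distribʳ-+ (θ a) b c n))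
                 (trans (⋆-cong (λ _ → refl) c-rec n) (⋆-distribˡ-+ a (θ c) d n)) ⟩
  ((θ a ⋆ c) n + (b ⋆ c) n) + ((a ⋆ θ c) n + (a ⋆ d) n)
    ≡⟨ +-interchange ((θ a ⋆ c) n) ((b ⋆ c) n) _ _ ⟩
  ((θ a ⋆ c) n + (a ⋆ θ c) n) + ((b ⋆ c) n + (a ⋆ d) n)
    ≡⟨ cong (_+ ((b ⋆ c) n + (a ⋆ d) n)) (⋆-leibniz a c n) ⟨
  θ (a ⋆ c) n + ((b ⋆ c) n + (a ⋆ d) n)
    ≡⟨ +-assoc (θ (a ⋆ c) n) _ _ ⟨
  θ (a ⋆ c) n + (b ⋆ c) n + (a ⋆ d) n
    ∎
  where open ≡-Reasoning

sumFrom1-cong : ∀ n {g h} → (∀ i → i ℕ.≤ n → g i ≡ h i) → sumFrom1 n g ≡ sumFrom1 n h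
sumFrom1-cong zero    g≡h = refl
sumFrom1-cong (suc n) g≡h =
  cong₂ _+_ (sumFrom1-cong n (λ i i≤n → g≡h i (ℕ.m≤n⇒m≤1+n i≤n))) (g≡h (suc n) ℕ.≤-refl)

⋆-sumFrom1 : ∀ a c n → (a ⋆ c) n ≡ a 0 * c n + sumFrom1 n (λ i → a i * c (n ℕ.∸ i))
⋆-sumFrom1 a c zero    = sym (+-identityʳ (a 0 * c 0))
⋆-sumFrom1 a c (suc n) = begin
  (a ⋆ c) (suc n)
    ≡⟨ ⋆-sucʳ a c n ⟩
  (a ⋆ c ∘ suc) n + a (suc n) * c 0
    ≡⟨ cong (_+ a (suc n) * c 0) (⋆-sumFrom1 a (c ∘ suc) n) ⟩
  a 0 * c (suc n) + sumFrom1 n (λ i → a i * c (suc (n ℕ.∸ i))) + a (suc n) * c 0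
    ≡⟨ +-assoc (a 0 * c (suc n)) _ _ ⟩
  a 0 * c (suc n) + (sumFrom1 n (λ i → a i * c (suc (n ℕ.∸ i))) + a (suc n) * c 0)
    ≡⟨ cong₂ (λ u v → a 0 * c (suc n) + (u + a (suc n) * c v))
         (sumFrom1-cong n (λ i i≤n → cong (λ w → a i * c w) (sym (ℕ.+-∸-assoc 1 i≤n)))) (sym (ℕ.n∸n≡0 n)) ⟩
  a 0 * c (suc n) + sumFrom1 (suc n) (λ i → a i * c (suc n ℕ.∸ i))
    ∎
  where open ≡-Reasoning

⋆-sumSplit : ∀ a c n →
  (a ⋆ c) (suc n) ≡ a 0 * c (suc n) + (sumSplit (suc n) (λ i j → a i * c j) + a (suc n) * c 0)
⋆-sumSplit a c n = trans (⋆-sumFrom1 a c (suc n))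
  (cong (λ j → a 0 * c (suc n) + (sumSplit (suc n) (λ i j → a i * c j) + a (suc n) * c j)) (ℕ.n∸n≡0 n))

recurrence-unique : ∀ (f : ℕ → ℚ → ℚ) {x y : ℕ → ℚ} →
  (∀ n → fromℕ (suc n) * x (suc n) ≡ f n (x n)) →
  (∀ n → fromℕ (suc n) * y (suc n) ≡ f n (y n)) →
  x 0 ≡ y 0 → ∀ n → x n ≡ y n
recurrence-unique f x-rec y-rec x₀≡y₀ zero    = x₀≡y₀
recurrence-unique f x-rec y-rec x₀≡y₀ (suc n) = *-cancelˡ-fromℕ (suc n)
  (trans (x-rec n) (trans (cong (f n) (recurrence-unique f x-rec y-rec x₀≡y₀ n)) (sym (y-rec n))))

-- The coefficients of A_k; Δζ (suc m) 0 = 0 because inv 0 = 0.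
Δζ : ℕ → ℕ → ℚ
Δζ zero      = ε
Δζ (suc m) i = ζ (i ℕ.∸ 1) (ones m) * inv i

ζ-ones-zero : ∀ m → ζ 0 (ones m) ≡ Δζ m 0
ζ-ones-zero zero    = refl
ζ-ones-zero (suc m) = sym (*-zeroʳ (ζ 0 (ones m)))

ζ-ones-suc : ∀ m i → ζ (suc i) (ones m) ≡ ζ i (ones m) + Δζ m (suc i)
ζ-ones-suc zero    i = refl
ζ-ones-suc (suc m) i = cong (_+_ (ζ i (ones (suc m))))
  (trans (cong (λ d → inv d * ζ i (ones m)) (ℕ.*-identityʳ (suc i))) (*-comm (inv (suc i)) (ζ i (ones m))))

Δζ-recurrence : ∀ m i → fromℕ (suc i) * Δζ (suc m) (suc i) ≡ θ (Δζ (suc m)) i + Δζ m i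
Δζ-recurrence m zero = begin
  fromℕ 1 * Δζ (suc m) 1        ≡⟨ fromℕ-*-*-inv 0 (ζ 0 (ones m)) ⟩
  ζ 0 (ones m)                  ≡⟨ ζ-ones-zero m ⟩
  Δζ m 0                        ≡⟨ +-identityˡ (Δζ m 0) ⟨
  0ℚ + Δζ m 0                   ≡⟨ cong (_+ Δζ m 0) (θ-zero (Δζ (suc m))) ⟨
  θ (Δζ (suc m)) 0 + Δζ m 0     ∎
  where open ≡-Reasoning
Δζ-recurrence m (suc i) = begin
  fromℕ (suc (suc i)) * Δζ (suc m) (suc (suc i)) ≡⟨ fromℕ-*-*-inv (suc i) (ζ (suc i) (ones m)) ⟩
  ζ (suc i) (ones m)                             ≡⟨ ζ-ones-suc m i ⟩
  ζ i (ones m) + Δζ m (suc i)                    ≡⟨ cong (_+ Δζ m (suc i)) (fromℕ-*-*-inv i (ζ i (ones m))) ⟨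
  θ (Δζ (suc m)) (suc i) + Δζ m (suc i)          ∎
  where open ≡-Reasoning

nCk*k![n∸k]!≡n! : ∀ {n k} → k ℕ.≤ n → (n C k) ℕ.* (k ! ℕ.* (n ℕ.∸ k) !) ≡ n !
nCk*k![n∸k]!≡n! {n} {k} k≤n = trans (cong (ℕ._* (k ! ℕ.* (n ℕ.∸ k) !)) (nCk≡n!/k![n-k]! k≤n))
  (m/n*n≡m {{k !* (n ℕ.∸ k) !≢0}} (k![n∸k]!∣n! k≤n))

centralBinom-*-!² : ∀ n → ((2 ℕ.* n) C n) ℕ.* (n ! ℕ.* n !) ≡ (2 ℕ.* n) !
centralBinom-*-!² n = begin
  ((2 ℕ.* n) C n) ℕ.* (n ! ℕ.* n !)               ≡⟨ cong (λ m → ((2 ℕ.* n) C n) ℕ.* (n ! ℕ.* m !)) 2n∸n≡n ⟨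
  ((2 ℕ.* n) C n) ℕ.* (n ! ℕ.* (2 ℕ.* n ℕ.∸ n) !) ≡⟨ nCk*k![n∸k]!≡n! (ℕ.m≤m+n n (n ℕ.+ 0)) ⟩
  (2 ℕ.* n) !                                     ∎
  where
  open ≡-Reasoning
  2n∸n≡n : 2 ℕ.* n ℕ.∸ n ≡ n
  2n∸n≡n = trans (cong (λ m → n ℕ.+ m ℕ.∸ n) (ℕ.+-identityʳ n)) (ℕ.m+n∸m≡n n n)

suc-*-centralBinom-suc : ∀ j → suc j ℕ.* ((2 ℕ.* suc j) C suc j) ≡ (4 ℕ.* j ℕ.+ 2) ℕ.* ((2 ℕ.* j) C j)
suc-*-centralBinom-suc j = ℕ.*-cancelʳ-≡ _ _ (suc j ℕ.* (j ! ℕ.* j !)) {{nonZero}} (begin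
  suc j ℕ.* C₁ ℕ.* (suc j ℕ.* (j ! ℕ.* j !))
    ≡⟨ regroupˡ (suc j) C₁ (j !) ⟩
  C₁ ℕ.* (suc j ! ℕ.* suc j !)
    ≡⟨ centralBinom-*-!² (suc j) ⟩
  (2 ℕ.* suc j) !
    ≡⟨ cong _! (ℕ.*-distribˡ-+ 2 1 j) ⟩
  (2 ℕ.+ 2 ℕ.* j) ℕ.* ((1 ℕ.+ 2 ℕ.* j) ℕ.* (2 ℕ.* j) !)
    ≡⟨ cong (λ m → (2 ℕ.+ 2 ℕ.* j) ℕ.* ((1 ℕ.+ 2 ℕ.* j) ℕ.* m)) (centralBinom-*-!² j) ⟨
  (2 ℕ.+ 2 ℕ.* j) ℕ.* ((1 ℕ.+ 2 ℕ.* j) ℕ.* (C₀ ℕ.* (j ! ℕ.* j !)))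
    ≡⟨ regroupʳ j C₀ (j !) ⟩
  (4 ℕ.* j ℕ.+ 2) ℕ.* C₀ ℕ.* (suc j ℕ.* (j ! ℕ.* j !))
    ∎)
  where
  open ≡-Reasoning
  C₀ = (2 ℕ.* j) C j
  C₁ = (2 ℕ.* suc j) C suc j
  nonZero : NonZero (suc j ℕ.* (j ! ℕ.* j !))
  nonZero = ℕ.m*n≢0 (suc j) (j ! ℕ.* j !) {{_}} {{ℕ.m*n≢0 _ _ {{j !≢0}} {{j !≢0}}}}
  regroupˡ : ∀ s c f → s ℕ.* c ℕ.* (s ℕ.* (f ℕ.* f)) ≡ c ℕ.* (s ℕ.* f ℕ.* (s ℕ.* f))
  regroupˡ = ℕ-solve-∀
  regroupʳ : ∀ j c f → (2 ℕ.+ 2 ℕ.* j) ℕ.* ((1 ℕ.+ 2 ℕ.* j) ℕ.* (c ℕ.* (f ℕ.* f)))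
                       ≡ (4 ℕ.* j ℕ.+ 2) ℕ.* c ℕ.* ((1 ℕ.+ j) ℕ.* (f ℕ.* f))
  regroupʳ = ℕ-solve-∀

centralRatio-recurrence : ∀ j → fromℕ (suc j) * centralRatio (suc j) ≡ θ centralRatio j + ½ * centralRatio j
centralRatio-recurrence j = *-cancelˡ-fromℕ (4 ℕ.^ suc j) {{m^n≢0 4 (suc j)}} (begin
  fromℕ (4 ℕ.^ suc j) * (fromℕ (suc j) * c₁)
    ≡⟨ x∙yz≈y∙xz (fromℕ (4 ℕ.^ suc j)) (fromℕ (suc j)) c₁ ⟩
  fromℕ (suc j) * (fromℕ (4 ℕ.^ suc j) * c₁)
    ≡⟨ cong (fromℕ (suc j) *_) (fromℕ-*-/ C₁ (4 ℕ.^ suc j) {{m^n≢0 4 (suc j)}}) ⟩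
  fromℕ (suc j) * fromℕ C₁
    ≡⟨ fromℕ-* (suc j) C₁ ⟨
  fromℕ (suc j ℕ.* C₁)
    ≡⟨ cong fromℕ (suc-*-centralBinom-suc j) ⟩
  fromℕ ((4 ℕ.* j ℕ.+ 2) ℕ.* C₀)
    ≡⟨ trans (fromℕ-* (4 ℕ.* j ℕ.+ 2) C₀)
             (cong (_* fromℕ C₀) (trans (fromℕ-+ (4 ℕ.* j) 2) (cong (_+ fromℕ 2) (fromℕ-* 4 j)))) ⟩
  (fromℕ 4 * fromℕ j + fromℕ 2) * fromℕ C₀
    ≡⟨ cong ((fromℕ 4 * fromℕ j + fromℕ 2) *_) (fromℕ-*-/ C₀ (4 ℕ.^ j) {{m^n≢0 4 j}}) ⟨
  (fromℕ 4 * fromℕ j + fromℕ 2) * (fromℕ (4 ℕ.^ j) * c₀)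
    ≡⟨ regroup (fromℕ j) (fromℕ (4 ℕ.^ j)) c₀ ⟩
  fromℕ 4 * fromℕ (4 ℕ.^ j) * (fromℕ j * c₀ + ½ * c₀)
    ≡⟨ cong (_* (fromℕ j * c₀ + ½ * c₀)) (fromℕ-* 4 (4 ℕ.^ j)) ⟨
  fromℕ (4 ℕ.^ suc j) * (θ centralRatio j + ½ * c₀)
    ∎)
  where
  open ≡-Reasoning
  C₀ = (2 ℕ.* j) C j
  C₁ = (2 ℕ.* suc j) C suc j
  c₀ = centralRatio j
  c₁ = centralRatio (suc j)
  regroup : ∀ u d x → (fromℕ 4 * u + fromℕ 2) * (d * x) ≡ fromℕ 4 * d * (u * x + ½ * x)
  regroup = solve-∀ ℚ-ring

fromℕ-odd-*-inv : ∀ n → (fromℕ 2 * fromℕ n + 1ℚ) * inv ((2 ℕ.* n ℕ.+ 1) ℕ.^ 1) ≡ 1ℚ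
fromℕ-odd-*-inv n = begin
  (fromℕ 2 * fromℕ n + 1ℚ) * inv ((2 ℕ.* n ℕ.+ 1) ℕ.^ 1)
    ≡⟨ cong₂ (λ u v → u * inv v) (sym (trans (fromℕ-suc (2 ℕ.* n)) (cong (_+ 1ℚ) (fromℕ-* 2 n))))
                                 (trans (ℕ.*-identityʳ (2 ℕ.* n ℕ.+ 1)) (ℕ.+-comm (2 ℕ.* n) 1)) ⟩
  fromℕ (suc (2 ℕ.* n)) * inv (suc (2 ℕ.* n))
    ≡⟨ fromℕ-*-inv (suc (2 ℕ.* n)) ⟩
  1ℚ ∎
  where open ≡-Reasoning

centralT : ℕ → ℕ → ℚ
centralT k n = centralRatio n * fromℕ (2 ℕ.^ k) * t n (ones k)

centralT-recurrence : ∀ m n →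
  fromℕ (suc n) * centralT (suc m) (suc n) ≡ θ (centralT (suc m)) n + centralT m n + ½ * centralT (suc m) n
centralT-recurrence m n = begin
  fromℕ (suc n) * (c₁ * fromℕ (2 ℕ.^ suc m) * (T + I * T′))
    ≡⟨ cong (λ u → fromℕ (suc n) * (c₁ * u * (T + I * T′))) (fromℕ-* 2 (2 ℕ.^ m)) ⟩
  fromℕ (suc n) * (c₁ * (fromℕ 2 * E) * (T + I * T′))
    ≡⟨ regroupˡ (fromℕ (suc n)) c₁ E T I T′ ⟩
  (fromℕ (suc n) * c₁) * (fromℕ 2 * E) * (T + I * T′)
    ≡⟨ cong (λ u → u * (fromℕ 2 * E) * (T + I * T′)) (centralRatio-recurrence n) ⟩
  (fromℕ n * c₀ + ½ * c₀) * (fromℕ 2 * E) * (T + I * T′)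
    ≡⟨ regroupʳ (fromℕ n) c₀ E T I T′ ⟩
  fromℕ n * (c₀ * (fromℕ 2 * E) * T) + c₀ * E * T′ * ((fromℕ 2 * fromℕ n + 1ℚ) * I)
    + ½ * (c₀ * (fromℕ 2 * E) * T)
    ≡⟨ cong₂ (λ u v → fromℕ n * (c₀ * u * T) + c₀ * E * T′ * v + ½ * (c₀ * u * T))
             (fromℕ-* 2 (2 ℕ.^ m)) (sym (fromℕ-odd-*-inv n)) ⟨
  θ (centralT (suc m)) n + c₀ * E * T′ * 1ℚ + ½ * centralT (suc m) n
    ≡⟨ cong (λ u → θ (centralT (suc m)) n + u + ½ * centralT (suc m) n) (*-identityʳ (centralT m n)) ⟩
  θ (centralT (suc m)) n + centralT m n + ½ * centralT (suc m) n
    ∎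
  where
  open ≡-Reasoning
  c₀ = centralRatio n
  c₁ = centralRatio (suc n)
  E  = fromℕ (2 ℕ.^ m)
  T  = t n (ones (suc m))
  T′ = t n (ones m)
  I  = inv ((2 ℕ.* n ℕ.+ 1) ℕ.^ 1)
  regroupˡ : ∀ s x e u i v → s * (x * (fromℕ 2 * e) * (u + i * v)) ≡ s * x * (fromℕ 2 * e) * (u + i * v)
  regroupˡ = solve-∀ ℚ-ring
  regroupʳ : ∀ s x e u i v → (s * x + ½ * x) * (fromℕ 2 * e) * (u + i * v)
    ≡ s * (x * (fromℕ 2 * e) * u) + x * e * v * ((fromℕ 2 * s + 1ℚ) * i)
      + ½ * (x * (fromℕ 2 * e) * u)
  regroupʳ = solve-∀ ℚ-ring

Δζ⋆centralRatio : ∀ k n → (Δζ k ⋆ centralRatio) n ≡ centralT k n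
Δζ⋆centralRatio zero    n = begin
  (ε ⋆ centralRatio) n       ≡⟨ ⋆-identityˡ centralRatio n ⟩
  centralRatio n             ≡⟨ *-identityʳ (centralRatio n) ⟨
  centralRatio n * 1ℚ        ≡⟨ *-identityʳ (centralRatio n * 1ℚ) ⟨
  centralT 0 n               ∎
  where open ≡-Reasoning
Δζ⋆centralRatio (suc m) = recurrence-unique step lhs-recurrence (centralT-recurrence m) initial
  where
  step : ℕ → ℚ → ℚ
  step n v = fromℕ n * v + centralT m n + ½ * v
  lhs-recurrence : ∀ n →
    fromℕ (suc n) * (Δζ (suc m) ⋆ centralRatio) (suc n) ≡ step n ((Δζ (suc m) ⋆ centralRatio) n)
  lhs-recurrence n = trans (⋆-recurrence (Δζ-recurrence m) centralRatio-recurrence n)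
    (cong₂ (λ u v → θ (Δζ (suc m) ⋆ centralRatio) n + u + v)
           (Δζ⋆centralRatio m n) (⋆-scaleʳ ½ (Δζ (suc m)) centralRatio n))
  initial : (Δζ (suc m) ⋆ centralRatio) 0 ≡ centralT (suc m) 0
  initial = trans (cong (_* 1ℚ) (*-zeroʳ (ζ 0 (ones m)))) (sym (*-zeroʳ (centralRatio 0 * fromℕ (2 ℕ.^ suc m))))

proposition4p1 : (n k : ℕ) → .{{_ : ℕ.NonZero n}} → .{{_ : ℕ.NonZero k}} →
    ζ (n ℕ.∸ 1) (ones (k ℕ.∸ 1)) * inv n
      + sumSplit n (λ i j → ζ (i ℕ.∸ 1) (ones (k ℕ.∸ 1)) * inv i * centralRatio j)
      ≡ centralRatio n * (+ (2 ℕ.^ k) / 1) * t n (ones k)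
proposition4p1 (suc n) (suc m) = begin
  a (suc n) + S
    ≡⟨ +-comm (a (suc n)) S ⟩
  S + a (suc n)
    ≡⟨ cong (_+_ S) (*-identityʳ (a (suc n))) ⟨
  S + a (suc n) * centralRatio 0
    ≡⟨ +-identityˡ (S + a (suc n) * centralRatio 0) ⟨
  0ℚ + (S + a (suc n) * centralRatio 0)
    ≡⟨ cong (_+ (S + a (suc n) * centralRatio 0)) a₀-term ⟨
  a 0 * centralRatio (suc n) + (S + a (suc n) * centralRatio 0)
    ≡⟨ ⋆-sumSplit a centralRatio n ⟨
  (a ⋆ centralRatio) (suc n)
    ≡⟨ Δζ⋆centralRatio (suc m) (suc n) ⟩
  centralT (suc m) (suc n)
    ∎
  where
  open ≡-Reasoning
  a = Δζ (suc m)
  S = sumSplit (suc n) (λ i j → a i * centralRatio j)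
  a₀-term : a 0 * centralRatio (suc n) ≡ 0ℚ
  a₀-term = trans (cong (_* centralRatio (suc n)) (*-zeroʳ (ζ 0 (ones m)))) (*-zeroˡ (centralRatio (suc n)))
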